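{- Let $a,t,s$ be positive integers with $t\ge a+1$ and $s\ge 2$. Then $R^{a+1}\big(SK^{(a)}_t,\partial K_s\big)\ge (s-1)\lfloor t/a\rfloor+1$.
   Context: $K^{(a)}_n$ is the complete $a$-uniform hypergraph on $n$ vertices and $K_n$ the complete graph. For an $a$-uniform hypergraph $\mathcal{H}$, its $(a+1)$-suspension $S\mathcal{H}$ is obtained by adding one fixed new vertex $u$ to every hyperedge: $V(S\mathcal{H})=V(\mathcal{H})\cup\{u\}$, $E(S\mathcal{H})=\{e\cup\{u\}:e\in E(\mathcal{H})\}$. The 2-shadow of a hypergraph is the graph of all pairs contained in some hyperedge; for a graph $G$, $\partial G$ is the set of $(a+1)$-uniform hypergraphs whose 2-shadow contains $G$ as a subgraph. For collections $\mathcal{F}_1,\mathcal{F}_2$ of $r$-uniform hypergraphs, $R^r(\mathcal{F}_1,\mathcal{F}_2)$ is the least $N$ such that every 2-coloring of the hyperedges of the complete $r$-uniform hypergraph on $N$ vertices contains a subhypergraph of the first color isomorphic to a member of $\mathcal{F}_1$ or one of the second color isomorphic to a member of $\mathcal{F}_2$. Here $r=a+1$. -}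

module Defs where

open import Data.Nat using (ℕ; zero; suc)
open import Data.Bool using (Bool; true; false; if_then_else_)
open import Data.Fin using (Fin; zero; suc)
open import Data.Fin.Subset using (Subset; ∣_∣; _∈_; ⁅_⁆; _∪_; ⊥)
open import Data.Vec using (Vec; []; _∷_)
open import Data.Product using (Σ; ∃; _×_; _,_)
open import Data.Sum using (_⊎_)
open import Relation.Binary.PropositionalEquality using (_≡_; refl; cong)
open import Relation.Nullary using (¬_)
open import Level using (Lift)
open import Function using (_∘_)
open import Function.Definitions using (Injective)

record Hypergraph : Set₁ where
  field
    n : ℕ
    E : Subset n → Set

open Hypergraph public

Uniform : ℕ → Hypergraph → Set
Uniform r H = ∀ e → E H e → ∣ e ∣ ≡ r

record Graph : Set₁ where
  field
    vn  : ℕ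
    Adj : Fin vn → Fin vn → Set

open Graph public

K⁽_⁾ : ℕ → ℕ → Hypergraph
K⁽ a ⁾ t = record { n = t ; E = λ e → ∣ e ∣ ≡ a }

-- suspension: new vertex u = zero (Fin (suc n)), old vertices shifted by suc
S : Hypergraph → Hypergraph
S H = record { n = suc (n H) ; E = SE }
  where
  SE : Subset (suc (n H)) → Set
  SE (b ∷ e) = (b ≡ true) × E H e

Kgraph : ℕ → Graph
Kgraph s = record { vn = s ; Adj = λ i j → ¬ (i ≡ j) }

InShadow : (H : Hypergraph) → Fin (n H) → Fin (n H) → Set
InShadow H x y = ∃ λ e → E H e × x ∈ e × y ∈ e

∂ : ℕ → Graph → Hypergraph → Set₁
∂ a G H = Lift _ (Uniform (suc a) H ×
  (Σ (Fin (vn G) → Fin (n H)) λ ψ → Injective _≡_ _≡_ ψ ×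
     (∀ i j → Adj G i j → InShadow H (ψ i) (ψ j))))

image : ∀ {m N} → (Fin m → Fin N) → Subset m → Subset N
image {zero} φ [] = ⊥
image {suc m} φ (b ∷ e) = (if b then ⁅ φ zero ⁆ else ⊥) ∪ image (φ ∘ suc) e

-- A 2-colouring of the hyperedges of the complete r-uniform hypergraph on
-- Fin N; only its values on r-element subsets matter.
Colouring : ℕ → Set
Colouring N = Subset N → Bool

ContainsIn : ∀ {N} → Colouring N → Bool → Hypergraph → Set
ContainsIn {N} c col H =
  Σ (Fin (n H) → Fin N) λ φ → Injective _≡_ _≡_ φ ×
    (∀ e → E H e → c (image φ e) ≡ col)

RamseyProp : (Hypergraph → Set₁) → (Hypergraph → Set₁) → ℕ → Set₁
RamseyProp F₁ F₂ N = (c : Colouring N) →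
  (Σ Hypergraph λ H → F₁ H × ContainsIn c true H) ⊎
  (Σ Hypergraph λ H → F₂ H × ContainsIn c false H)

-- R^r(F₁,F₂) ≥ M : every N with the Ramsey property is ≥ M
-- (vacuous, i.e. R = ∞, if there is none)
open import Data.Nat using (_≤_)
RamseyAtLeast : (Hypergraph → Set₁) → (Hypergraph → Set₁) → ℕ → Set₁
RamseyAtLeast F₁ F₂ M = ∀ N → RamseyProp F₁ F₂ N → M ≤ N

-- Cut the vertices 0 … N-1 into consecutive blocks of q = ⌊t/a⌋ vertices and colour a
-- hyperedge red when two of its vertices lie in a common block, blue otherwise.  If
-- N ≤ (s-1)q there are at most s-1 blocks, so among any s vertices two share a block; a
-- blue hypergraph whose shadow contains K_s would need a blue edge through both.  On the
-- other hand the t+1 vertices of a red suspension of K⁽ᵃ⁾_t take only q offsets inside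
-- their blocks, and t+1 > qa, so some offset is taken by a+1 of them; these lie in
-- distinct blocks, at most one of them in the block of the apex, and the remaining a
-- together with the apex span a blue edge.
module Submission where

open import Defs
open import Data.Nat using (ℕ; suc; _+_; _*_; _∸_; _/_; _≤_; NonZero)
open import Relation.Binary.PropositionalEquality using (_≡_)

open import Data.Bool using (false; true; not; if_then_else_)
open import Data.Empty using (⊥-elim)
open import Data.Fin as Fin using (Fin; zero; suc; toℕ; fromℕ<)
open import Data.Fin.Properties
  using (toℕ-injective; toℕ<n; fromℕ<-injective; suc-injective; pigeonhole; any?; all?; <⇒≢)
open import Data.Fin.Subset
  using (Subset; inside; outside; ∣_∣; _∈_; _∉_; _⊆_; _∪_; _─_; _-_; ⁅_⁆; ⊤; ⊥)
open import Data.Fin.Subset.Properties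
  using (_∈?_; ⊆-refl; ⊥⊆; s⊆s; out⊆; ∉⊥; x∈⁅x⁆; x∈⁅y⁆⇒x≡y; x∉⁅y⁆⇒x≢y; ∣⁅x⁆∣≡1; ∣⊥∣≡0;
         ∣⊤∣≡n; x∈p∪q⁺; x∈p∪q⁻; p─q⊆p; x∈p∧x≢y⇒x∈p-y; p⊆q⇒∣p∣≤∣q∣)
open import Data.Nat as ℕ using (zero; _<_; _<?_; _≤?_; z≤n; s≤s; >-nonZero)
open import Data.Nat.DivMod using (_%_; m≡m%n+[m/n]*n; m%n<n; m/n*n≤m; m<n*o⇒m/o<n; m≥n⇒m/n>0)
open import Data.Nat.Properties
  using (≤-refl; ≤-reflexive; ≤-trans; <-≤-trans; <⇒≤; <⇒≱; ≮⇒≥; ≰⇒>; ≤-pred; n≤1+n; n<1+n;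
         m<1+n⇒m<n∨m≡n; m<1+n⇒m≤n; +-comm; +-suc; +-monoʳ-≤; +-mono-≤; anyUpTo?;
         module ≤-Reasoning)
open import Data.Product using (∃; _×_; _,_)
open import Data.Sum using (inj₁; inj₂)
open import Data.Vec using ([]; _∷_; tabulate; here; there)
open import Data.Vec.Properties using (lookup∘tabulate; []=⇒lookup; lookup⇒[]=)
open import Function using (_∘_; case_of_)
open import Level using (Level; lift)
open import Relation.Binary.PropositionalEquality
  using (refl; sym; trans; cong; cong₂; subst; _≢_; module ≡-Reasoning)
open import Relation.Nullary using (¬_; Dec; yes; no; does; contradiction)
open import Relation.Nullary.Decidable using (isNo; isYes≗does; dec-true; _×-dec_; _→-dec_)
open import Relation.Unary using (Pred; Decidable)

private
  variable
    ℓ : Level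
    k m : ℕ

satisfying : {P : Pred (Fin m) ℓ} → Decidable P → Subset m
satisfying P? = tabulate (does ∘ P?)

∈-satisfying⁺ : {P : Pred (Fin m) ℓ} (P? : Decidable P) {x : Fin m} → P x → x ∈ satisfying P?
∈-satisfying⁺ P? {x} px =
  lookup⇒[]= x _ (trans (lookup∘tabulate (does ∘ P?) x) (dec-true (P? x) px))

∈-satisfying⁻ : {P : Pred (Fin m) ℓ} (P? : Decidable P) {x : Fin m} → x ∈ satisfying P? → P x
∈-satisfying⁻ P? {x} x∈ with P? x | trans (sym (lookup∘tabulate (does ∘ P?) x)) ([]=⇒lookup x∈)
... | yes px | _  = px
... | no  _  | ()

∈-image⁺ : ∀ (φ : Fin k → Fin m) {e i} → i ∈ e → φ i ∈ image φ e
∈-image⁺ φ {inside ∷ e} here      = x∈p∪q⁺ (inj₁ (x∈⁅x⁆ (φ zero)))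
∈-image⁺ φ {s ∷ e}      (there i∈e) =
  x∈p∪q⁺ {p = if s then ⁅ φ zero ⁆ else ⊥} (inj₂ (∈-image⁺ (φ ∘ suc) i∈e))

∈-image⁻ : ∀ (φ : Fin k → Fin m) {e x} → x ∈ image φ e → ∃ λ i → i ∈ e × φ i ≡ x
∈-image⁻ {zero}  φ {[]}    x∈ = contradiction x∈ ∉⊥
∈-image⁻ {suc k} φ {s ∷ e} x∈ with s | x∈p∪q⁻ _ (image (φ ∘ suc) e) x∈
... | inside  | inj₁ x∈⁅φ0⁆ = zero , here , sym (x∈⁅y⁆⇒x≡y _ x∈⁅φ0⁆)
... | outside | inj₁ x∈⊥    = contradiction x∈⊥ ∉⊥
... | _       | inj₂ x∈rest with i , i∈e , refl ← ∈-image⁻ (φ ∘ suc) x∈rest =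
  suc i , there i∈e , refl

∣p∪q∣≤∣p∣+∣q∣ : (p q : Subset m) → ∣ p ∪ q ∣ ≤ ∣ p ∣ + ∣ q ∣
∣p∪q∣≤∣p∣+∣q∣ []            []            = z≤n
∣p∪q∣≤∣p∣+∣q∣ (inside  ∷ p) (inside  ∷ q) =
  s≤s (≤-trans (∣p∪q∣≤∣p∣+∣q∣ p q) (+-monoʳ-≤ ∣ p ∣ (n≤1+n ∣ q ∣)))
∣p∪q∣≤∣p∣+∣q∣ (inside  ∷ p) (outside ∷ q) = s≤s (∣p∪q∣≤∣p∣+∣q∣ p q)
∣p∪q∣≤∣p∣+∣q∣ (outside ∷ p) (inside  ∷ q) =
  ≤-trans (s≤s (∣p∪q∣≤∣p∣+∣q∣ p q)) (≤-reflexive (sym (+-suc ∣ p ∣ ∣ q ∣)))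
∣p∪q∣≤∣p∣+∣q∣ (outside ∷ p) (outside ∷ q) = ∣p∪q∣≤∣p∣+∣q∣ p q

x∈p─q⇒x∉q : {p q : Subset m} {x : Fin m} → x ∈ p ─ q → x ∉ q
x∈p─q⇒x∉q {p = _ ∷ p} {inside ∷ q} (there x∈p─q) (there x∈q) = x∈p─q⇒x∉q {p = p} x∈p─q x∈q
x∈p─q⇒x∉q {p = _ ∷ p} {outside ∷ q} (there x∈p─q) (there x∈q) = x∈p─q⇒x∉q {p = p} x∈p─q x∈q

x∈p-y⇒x≢y : {p : Subset m} {x y : Fin m} → x ∈ p - y → x ≢ y
x∈p-y⇒x≢y {p = p} x∈p-y = x∉⁅y⁆⇒x≢y (x∈p─q⇒x∉q {p = p} x∈p-y)

∣p∣≤1+∣p-x∣ : (p : Subset m) (x : Fin m) → ∣ p ∣ ≤ suc ∣ p - x ∣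
∣p∣≤1+∣p-x∣ p x = begin
  ∣ p ∣                   ≤⟨ p⊆q⇒∣p∣≤∣q∣ p⊆⁅x⁆∪p-x ⟩
  ∣ ⁅ x ⁆ ∪ (p - x) ∣     ≤⟨ ∣p∪q∣≤∣p∣+∣q∣ ⁅ x ⁆ (p - x) ⟩
  ∣ ⁅ x ⁆ ∣ + ∣ p - x ∣   ≡⟨ cong (_+ ∣ p - x ∣) (∣⁅x⁆∣≡1 x) ⟩
  suc ∣ p - x ∣           ∎
  where
  open ≤-Reasoning
  p⊆⁅x⁆∪p-x : p ⊆ ⁅ x ⁆ ∪ (p - x)
  p⊆⁅x⁆∪p-x {y} y∈p with y Fin.≟ x
  ... | yes refl = x∈p∪q⁺ (inj₁ (x∈⁅x⁆ x))
  ... | no  y≢x  = x∈p∪q⁺ (inj₂ (x∈p∧x≢y⇒x∈p-y y∈p y≢x))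

⊆-ofSize : (p : Subset m) {k : ℕ} → k ≤ ∣ p ∣ → ∃ λ r → r ⊆ p × ∣ r ∣ ≡ k
⊆-ofSize {m} p {zero} _ = ⊥ , ⊥⊆ , ∣⊥∣≡0 m
⊆-ofSize (inside ∷ p) {suc k} (s≤s k≤∣p∣) with r , r⊆p , ∣r∣≡k ← ⊆-ofSize p k≤∣p∣ =
  inside ∷ r , s⊆s r⊆p , cong suc ∣r∣≡k
⊆-ofSize (outside ∷ p) {suc k} k<∣p∣ with r , r⊆p , ∣r∣≡k ← ⊆-ofSize p k<∣p∣ =
  outside ∷ r , out⊆ r⊆p , ∣r∣≡k

module _ (h : Fin m → ℕ) where

  fibre : ℕ → Subset m
  fibre r = satisfying (λ i → h i ℕ.≟ r)

  below : ℕ → Subset m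
  below k = satisfying (λ i → h i <? k)

  ∣below∣≤ : ∀ {q a} → (∀ {r} → r < q → ∣ fibre r ∣ ≤ a) → ∀ {k} → k ≤ q → ∣ below k ∣ ≤ k * a
  ∣below∣≤ _ {zero} _ = ≤-trans (p⊆q⇒∣p∣≤∣q∣ below0⊆⊥) (≤-reflexive (∣⊥∣≡0 m))
    where
    below0⊆⊥ : below 0 ⊆ ⊥
    below0⊆⊥ i∈ = contradiction (∈-satisfying⁻ (λ i → h i <? 0) i∈) λ ()
  ∣below∣≤ {a = a} ∣fibre∣≤a {suc k} k<q = begin
    ∣ below (suc k) ∣         ≤⟨ p⊆q⇒∣p∣≤∣q∣ split ⟩
    ∣ fibre k ∪ below k ∣     ≤⟨ ∣p∪q∣≤∣p∣+∣q∣ (fibre k) (below k) ⟩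
    ∣ fibre k ∣ + ∣ below k ∣ ≤⟨ +-mono-≤ (∣fibre∣≤a k<q) (∣below∣≤ ∣fibre∣≤a (<⇒≤ k<q)) ⟩
    a + k * a                 ∎
    where
    open ≤-Reasoning
    split : below (suc k) ⊆ fibre k ∪ below k
    split i∈ with m<1+n⇒m<n∨m≡n (∈-satisfying⁻ (λ i → h i <? suc k) i∈)
    ... | inj₁ hi<k = x∈p∪q⁺ (inj₂ (∈-satisfying⁺ (λ i → h i <? k) hi<k))
    ... | inj₂ hi≡k = x∈p∪q⁺ (inj₁ (∈-satisfying⁺ (λ i → h i ℕ.≟ k) hi≡k))

  fibre-pigeonhole : ∀ {q a} → (∀ i → h i < q) → q * a < m → ∃ λ r → a < ∣ fibre r ∣
  fibre-pigeonhole {q} {a} h<q qa<m with anyUpTo? (λ r → a <? ∣ fibre r ∣) q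
  ... | yes (r , _ , a<∣fibre∣) = r , a<∣fibre∣
  ... | no ∄large = contradiction m≤qa (<⇒≱ qa<m)
    where
    open ≤-Reasoning
    m≤qa : m ≤ q * a
    m≤qa = begin
      m           ≡⟨ sym (∣⊤∣≡n m) ⟩
      ∣ ⊤ {m} ∣   ≤⟨ p⊆q⇒∣p∣≤∣q∣ {p = ⊤} (λ {i} _ → ∈-satisfying⁺ (λ i → h i <? q) (h<q i)) ⟩
      ∣ below q ∣ ≤⟨ ∣below∣≤ (λ {r} r<q → ≮⇒≥ λ a< → ∄large (r , r<q , a<)) ≤-refl ⟩
      q * a       ∎

InjectiveOn : (Fin m → ℕ) → Subset m → Set
InjectiveOn f X = ∀ x y → x ∈ X → y ∈ X → f x ≡ f y → x ≡ y

injectiveOn? : (f : Fin m → ℕ) (X : Subset m) → Dec (InjectiveOn f X)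
injectiveOn? f X =
  all? λ x → all? λ y → x ∈? X →-dec y ∈? X →-dec f x ℕ.≟ f y →-dec x Fin.≟ y

injectiveOn-⊆ : ∀ {f : Fin m → ℕ} {X Y} → Y ⊆ X → InjectiveOn f X → InjectiveOn f Y
injectiveOn-⊆ Y⊆X inj x y x∈ y∈ = inj x y (Y⊆X x∈) (Y⊆X y∈)

injectiveOn-image : ∀ (f : Fin m → ℕ) (φ : Fin k → Fin m) {e} →
                    InjectiveOn (f ∘ φ) e → InjectiveOn f (image φ e)
injectiveOn-image f φ inj x y x∈ y∈ fx≡fy
  with i , i∈e , refl ← ∈-image⁻ φ x∈ | j , j∈e , refl ← ∈-image⁻ φ y∈ =
  cong φ (inj i j i∈e j∈e fx≡fy)

-- As f is injective on X, X meets the class f ⁻¹ c at most once: one removal suffices.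
dropClass : ∀ (f : Fin m → ℕ) c {X} → InjectiveOn f X →
            ∃ λ Y → Y ⊆ X × ∣ X ∣ ≤ suc ∣ Y ∣ × (∀ {i} → i ∈ Y → f i ≢ c)
dropClass f c {X} inj with any? (λ i → i ∈? X ×-dec f i ℕ.≟ c)
... | yes (z , z∈X , fz≡c) = X - z , p─q⊆p X ⁅ z ⁆ , ∣p∣≤1+∣p-x∣ X z , avoid
  where
  avoid : ∀ {i} → i ∈ X - z → f i ≢ c
  avoid i∈ fi≡c =
    x∈p-y⇒x≢y {p = X} i∈ (inj _ z (p─q⊆p X ⁅ z ⁆ i∈) z∈X (trans fi≡c (sym fz≡c)))
... | no ∄z = X , ⊆-refl , n≤1+n ∣ X ∣ , λ {i} i∈ fi≡c → ∄z (i , i∈ , fi≡c)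

injectiveOn-∷ : ∀ (f : Fin (suc m) → ℕ) {e} → InjectiveOn (f ∘ suc) e →
                (∀ {i} → i ∈ e → f (suc i) ≢ f zero) → InjectiveOn f (inside ∷ e)
injectiveOn-∷ f inj avoid zero    zero    _          _          _  = refl
injectiveOn-∷ f inj avoid zero    (suc j) _          (there j∈) f≡ = contradiction (sym f≡) (avoid j∈)
injectiveOn-∷ f inj avoid (suc i) zero    (there i∈) _          f≡ = contradiction f≡ (avoid i∈)
injectiveOn-∷ f inj avoid (suc i) (suc j) (there i∈) (there j∈) f≡ = cong suc (inj i j i∈ j∈ f≡)

injectiveOn-cone : ∀ (f : Fin (suc m) → ℕ) {a} Y → InjectiveOn f Y →
                   (∀ {i} → i ∈ Y → f i ≢ f zero) → a ≤ ∣ Y ∣ →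
                   ∃ λ e → ∣ e ∣ ≡ a × InjectiveOn f (inside ∷ e)
injectiveOn-cone f (inside  ∷ Y) _   avoid _ = contradiction refl (avoid here)
injectiveOn-cone f (outside ∷ Y) inj avoid a≤∣Y∣ with e , e⊆Y , ∣e∣≡a ← ⊆-ofSize Y a≤∣Y∣ =
  e , ∣e∣≡a ,
  injectiveOn-∷ f (λ i j i∈ j∈ f≡ → suc-injective (inj _ _ (there (e⊆Y i∈)) (there (e⊆Y j∈)) f≡))
                  (λ i∈ → avoid (there (e⊆Y i∈)))

injectiveOn-fibre : ∀ (κ π : Fin m → ℕ) → (∀ {i j} → κ i ≡ κ j → π i ≡ π j → i ≡ j) →
                    ∀ r → InjectiveOn κ (fibre π r)
injectiveOn-fibre κ π κπ-injective r x y x∈ y∈ κx≡κy =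
  κπ-injective κx≡κy (trans (∈-satisfying⁻ (λ i → π i ℕ.≟ r) x∈)
                        (sym (∈-satisfying⁻ (λ i → π i ℕ.≟ r) y∈)))

injectiveOn-extension : ∀ {q a} (κ π : Fin (suc m) → ℕ) → (∀ i → π i < q) →
                        (∀ {i j} → κ i ≡ κ j → π i ≡ π j → i ≡ j) →
                        q * a ≤ m → ∃ λ e → ∣ e ∣ ≡ a × InjectiveOn κ (inside ∷ e)
injectiveOn-extension κ π π<q κπ-injective qa≤m
  with r , a<∣F∣ ← fibre-pigeonhole π π<q (s≤s qa≤m)
  with injOnF ← injectiveOn-fibre κ π κπ-injective r
  with Y , Y⊆F , ∣F∣≤1+∣Y∣ , avoid ← dropClass κ (κ zero) injOnF =
  injectiveOn-cone κ Y (injectiveOn-⊆ Y⊆F injOnF) avoid (≤-pred (≤-trans a<∣F∣ ∣F∣≤1+∣Y∣))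

module BlockColouring (q : ℕ) .{{_ : NonZero q}} (N : ℕ) where

  block offset : Fin N → ℕ
  block  v = toℕ v / q
  offset v = toℕ v % q

  block-offset-injective : ∀ {u v} → block u ≡ block v → offset u ≡ offset v → u ≡ v
  block-offset-injective {u} {v} bu≡bv ou≡ov = toℕ-injective (begin
    toℕ u                   ≡⟨ m≡m%n+[m/n]*n (toℕ u) q ⟩
    offset u + block u * q  ≡⟨ cong₂ (λ o b → o + b * q) ou≡ov bu≡bv ⟩
    offset v + block v * q  ≡⟨ sym (m≡m%n+[m/n]*n (toℕ v) q) ⟩
    toℕ v                   ∎)
    where open ≡-Reasoning

  colour : Colouring N
  colour X = isNo (injectiveOn? block X)

  injectiveOn⇒blue : ∀ {X} → InjectiveOn block X → colour X ≡ false
  injectiveOn⇒blue {X} inj =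
    cong not (trans (isYes≗does (injectiveOn? block X)) (dec-true (injectiveOn? block X) inj))

  blue⇒injectiveOn : ∀ {X} → colour X ≡ false → InjectiveOn block X
  blue⇒injectiveOn {X} blue with injectiveOn? block X | blue
  ... | yes inj | _ = inj

  block< : ∀ {k} → N ≤ k * q → ∀ v → block v < k
  block< N≤kq v = m<n*o⇒m/o<n (<-≤-trans (toℕ<n v) N≤kq)

  noRedSuspension : ∀ {a t} → q * a ≤ t → ¬ ContainsIn colour true (S (K⁽ a ⁾ t))
  noRedSuspension qa≤t (φ , φ-injective , red)
    with e , ∣e∣≡a , inj ← injectiveOn-extension (block ∘ φ) (offset ∘ φ)
                             (λ i → m%n<n (toℕ (φ i)) q)
                             (λ bφ≡ oφ≡ → φ-injective (block-offset-injective bφ≡ oφ≡)) qa≤t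
    with () ← trans (sym (red (inside ∷ e) (refl , ∣e∣≡a)))
                    (injectiveOn⇒blue (injectiveOn-image block φ inj))

  noBlueShadowClique : ∀ {a k} → N ≤ k * q → ∀ H → ∂ a (Kgraph (suc k)) H →
                       ¬ ContainsIn colour false H
  noBlueShadowClique {k = k} N≤kq H (lift (_ , ψ , ψ-injective , shadow)) (φ , φ-injective , blue)
    with i , j , i<j , same ← pigeonhole (n<1+n k) (λ i → fromℕ< (block< N≤kq (φ (ψ i))))
    with e , e∈H , ψi∈e , ψj∈e ← shadow i j (<⇒≢ i<j) =
    <⇒≢ i<j (ψ-injective (φ-injective
      (blue⇒injectiveOn (blue e e∈H) _ _ (∈-image⁺ φ ψi∈e) (∈-image⁺ φ ψj∈e)
        (fromℕ<-injective _ _ (block< N≤kq (φ (ψ i))) (block< N≤kq (φ (ψ j))) same))))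

proposition4p5 : (a t s : ℕ) → .{{_ : NonZero a}} → suc a ≤ t → 2 ≤ s →
    RamseyAtLeast (λ H → H ≡ S (K⁽ a ⁾ t)) (∂ a (Kgraph s)) ((s ∸ 1) * (t / a) + 1)
proposition4p5 a t zero    _   ()
proposition4p5 a t (suc k) a<t _  N ramsey with k * (t / a) + 1 ≤? N
... | yes bound = bound
... | no  ¬bound = ⊥-elim (case ramsey colour of λ where
    (inj₁ (_ , refl , red))  → noRedSuspension (m/n*n≤m t a) red
    (inj₂ (H , H∈∂ , blue)) → noBlueShadowClique N≤kq H H∈∂ blue)
  where
  instance
    q≢0 : NonZero (t / a)
    q≢0 = >-nonZero (m≥n⇒m/n>0 (<⇒≤ a<t))
  open BlockColouring (t / a) N
  N≤kq : N ≤ k * (t / a)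
  N≤kq = m<1+n⇒m≤n (subst (N <_) (+-comm _ 1) (≰⇒> ¬bound))
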